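{- Let $M_\infty$ be as in the context and define $\in:M_\infty\to M_\infty\to\mathrm{Type}$ by $x\in y:=\sum_{a:A}f\,a=x$ where $\mathrm{desup}_\infty y=(A,f)$. Then $(M_\infty,\in)$, with any ordered pairing structure $\langle -,-\rangle$, satisfies multiset anti-foundation: for every graph $g:M_\infty$ the type $$\sum_{d:M_\infty\to M_\infty}\ \prod_{x,z:M_\infty}\Big(z\in d\,x\ \simeq\ \sum_{y:M_\infty}(\langle x,y\rangle\in g)\times(d\,y=z)\Big)$$ is contractible.
   Context: We work in homotopy type theory with a univalent universe $U$ of small types contained in a larger univalent universe $\mathrm{Type}$. $M_\infty$ is the M-type $\mathrm{M}_{A:U}A$, i.e. the terminal coalgebra of $X\mapsto\sum_{A:U}(A\to X)$, with destructor $\mathrm{desup}_\infty:M_\infty\to\sum_{A:U}(A\to M_\infty)$ (an equivalence) and, for each $m:X\to\sum_{A:U}(A\to X)$, a unique coalgebra morphism $X\to M_\infty$; $M_\infty$ is locally $U$-small (all identity types equivalent to types in $U$). An ordered pairing structure is $\langle -,-\rangle:M_\infty\to M_\infty\to M_\infty$ such that the canonical map $(a=a')\times(b=b')\to(\langle a,b\rangle=\langle a',b'\rangle)$ is an equivalence for all $a,b,a',b'$. An element $g$ is a graph if $\prod_{e}(e\in g)\to\sum_{a,b}e=\langle a,b\rangle$. -}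

{-# OPTIONS --without-K #-}
module Defs where

open import Level using (Level; _⊔_; suc)
open import Data.Product using (Σ; _,_; proj₁; proj₂; _×_)
open import Relation.Binary.PropositionalEquality using (_≡_; refl; cong₂)

private variable ℓ ℓ' ℓ'' : Level

isContr : Set ℓ → Set ℓ
isContr A = Σ A λ c → (x : A) → c ≡ x

fiber : {A : Set ℓ} {B : Set ℓ'} → (A → B) → B → Set (ℓ ⊔ ℓ')
fiber {A = A} f b = Σ A λ a → f a ≡ b

isEquiv : {A : Set ℓ} {B : Set ℓ'} → (A → B) → Set (ℓ ⊔ ℓ')
isEquiv {B = B} f = (b : B) → isContr (fiber f b)

_≃_ : Set ℓ → Set ℓ' → Set (ℓ ⊔ ℓ')
A ≃ B = Σ (A → B) isEquiv

idIsEquiv : (A : Set ℓ) → isEquiv (λ (x : A) → x)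
idIsEquiv A b = (b , refl) , λ { (a , refl) → refl }

idtoeqv : {A B : Set ℓ} → A ≡ B → A ≃ B
idtoeqv {A = A} refl = (λ x → x) , idIsEquiv A

Univalence : (ℓ : Level) → Set (suc ℓ)
Univalence ℓ = (A B : Set ℓ) → isEquiv (idtoeqv {A = A} {B = B})

happly : {A : Set ℓ} {B : A → Set ℓ'} {f g : (a : A) → B a} →
         f ≡ g → (a : A) → f a ≡ g a
happly refl a = refl

FunExt : (ℓ ℓ' : Level) → Set (suc (ℓ ⊔ ℓ'))
FunExt ℓ ℓ' = {A : Set ℓ} {B : A → Set ℓ'} (f g : (a : A) → B a) →
              isEquiv (happly {f = f} {g = g})

-- The universe U of small types is Set (= Set₀); the large universe
-- Type is Set₁.  Polynomial functor X ↦ Σ (A : U) (A → X).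

P : Set₁ → Set₁
P X = Σ Set λ A → A → X

Pmap : {X Y : Set₁} → (X → Y) → P X → P Y
Pmap h (A , f) = A , λ a → h (f a)

record MInfty : Set₂ where
  field
    M       : Set₁
    desup   : M → P M
    desupEq : isEquiv desup
    final   : (X : Set₁) (m : X → P X) →
              isContr (Σ (X → M) λ h → (x : X) → desup (h x) ≡ Pmap h (m x))
    locSmall : (x y : M) → Σ Set λ T → T ≃ (x ≡ y)

module _ (𝕄 : MInfty) where
  open MInfty 𝕄

  _∈_ : M → M → Set₁
  x ∈ y = Σ (proj₁ (desup y)) λ a → proj₂ (desup y) a ≡ x

  pairMap : (p : M → M → M) (a b a' b' : M) →
            (a ≡ a') × (b ≡ b') → p a b ≡ p a' b'
  pairMap p a b a' b' (e₁ , e₂) = cong₂ p e₁ e₂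

  record Pairing : Set₁ where
    field
      ⟨_,_⟩  : M → M → M
      pairEq : (a b a' b' : M) → isEquiv (pairMap ⟨_,_⟩ a b a' b')

  isGraph : Pairing → M → Set₁
  isGraph π g = (e : M) → e ∈ g → Σ M λ a → Σ M λ b → e ≡ Pairing.⟨_,_⟩ π a b

  MAFA-type : Pairing → M → Set₁
  MAFA-type π g =
    Σ (M → M) λ d → (x z : M) →
      (z ∈ d x) ≃ (Σ M λ y → (Pairing.⟨_,_⟩ π x y ∈ g) × (d y ≡ z))

{-# OPTIONS --without-K #-}

-- The graph g gives a P-coalgebra on M∞ sending x to the small family of
-- successors y with ⟨ x , y ⟩ ∈ g (smallness from local U-smallness of M∞).
-- A decoration d satisfies the MAFA condition at x iff desup (d x) and the
-- d-image of the successor family have equivalent fibres over every z; by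
-- univalence of U, an element of P M∞ is determined up to a contractible
-- choice by its fibres, so that condition is a retract of the path type
-- desup (d x) ≡ Pmap d (successors x).  The MAFA type is thus a retract of
-- the type of coalgebra morphisms into M∞, which is contractible.

module Submission where

open import Level using (Level; _⊔_; 0ℓ)
open import Data.Product using (Σ; _,_; proj₁; proj₂; _×_)
open import Data.Product.Properties using (Σ-≡,≡→≡)
open import Relation.Binary.PropositionalEquality using (_≡_; refl; sym; trans; cong; subst)
open import Relation.Binary.PropositionalEquality.Properties using (trans-reflʳ; subst-subst-sym)
open import Defs

private variable
  ℓ ℓ' ℓ'' : Level
  A : Set ℓ
  B : Set ℓ'
  C : Set ℓ''

trans-sym-cancel : {x y z : A} (p : x ≡ y) (q : x ≡ z) → trans p (trans (sym p) q) ≡ q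
trans-sym-cancel refl q = refl

sym-trans-cancel : {x y z : A} (p : x ≡ y) (q : y ≡ z) → trans (sym p) (trans p q) ≡ q
sym-trans-cancel refl q = refl

_◁_ : Set ℓ → Set ℓ' → Set (ℓ ⊔ ℓ')
A ◁ B = Σ (B → A) λ r → Σ (A → B) λ s → (a : A) → r (s a) ≡ a

◁-isContr : A ◁ B → isContr B → isContr A
◁-isContr (r , s , rs) (c , contract) = r c , λ a → trans (cong r (contract (s a))) (rs a)

◁-trans : A ◁ B → B ◁ C → A ◁ C
◁-trans (r , s , rs) (r' , s' , rs') =
  (λ c → r (r' c)) , (λ a → s' (s a)) , λ a → trans (cong r (rs' (s a))) (rs a)

Σ-◁ : {X : Set ℓ} {F : X → Set ℓ'} {G : X → Set ℓ''} → ((x : X) → F x ◁ G x) → Σ X F ◁ Σ X G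
Σ-◁ ρ = (λ (x , b) → x , proj₁ (ρ x) b) , (λ (x , a) → x , proj₁ (proj₂ (ρ x)) a) ,
        λ (x , a) → cong (x ,_) (proj₂ (proj₂ (ρ x)) a)

funext : FunExt ℓ ℓ' → {X : Set ℓ} {F : X → Set ℓ'} {f g : (x : X) → F x} →
         ((x : X) → f x ≡ g x) → f ≡ g
funext fe {f = f} {g} H = proj₁ (proj₁ (fe f g H))

Π-◁ : {X : Set ℓ} {F : X → Set ℓ'} {G : X → Set ℓ''} → FunExt ℓ ℓ' →
      ((x : X) → F x ◁ G x) → ((x : X) → F x) ◁ ((x : X) → G x)
Π-◁ fe ρ = (λ g x → proj₁ (ρ x) (g x)) , (λ f x → proj₁ (proj₂ (ρ x)) (f x)) ,
           λ f → funext fe (λ x → proj₂ (proj₂ (ρ x)) (f x))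

isContrSingl : (a : A) → isContr (Σ A λ x → x ≡ a)
isContrSingl a = (a , refl) , λ { (x , refl) → refl }

isContrΣ : {F : A → Set ℓ'} → isContr A → ((a : A) → isContr (F a)) → isContr (Σ A F)
isContrΣ {A = A} {F = F} (c , contract) contrF = (c , proj₁ (contrF c)) , λ (a , b) → go a (contract a) b
  where
  go : (a : A) → c ≡ a → (b : F a) → (c , proj₁ (contrF c)) ≡ (a , b)
  go a refl b = cong (c ,_) (proj₂ (contrF c) b)

isContrHomotopySingl : {A : Set ℓ} {B : Set ℓ'} → FunExt ℓ ℓ' → (g : A → B) →
  isContr (Σ (A → B) λ h → (a : A) → h a ≡ g a)
isContrHomotopySingl fe g = ◁-isContr
  ((λ (h , p) → h , happly p) , (λ (h , H) → h , funext fe H) ,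
   λ (h , H) → cong (h ,_) (proj₂ (proj₁ (fe h g H))))
  (isContrSingl g)

invEq : A ≃ B → B → A
invEq e b = proj₁ (proj₁ (proj₂ e b))

secEq : (e : A ≃ B) (b : B) → proj₁ e (invEq e b) ≡ b
secEq e b = proj₂ (proj₁ (proj₂ e b))

retEq : (e : A ≃ B) (a : A) → invEq e (proj₁ e a) ≡ a
retEq e a = cong proj₁ (proj₂ (proj₂ e (proj₁ e a)) (a , refl))

isoToIsEquiv : (f : A → B) (g : B → A) → ((a : A) → g (f a) ≡ a) → ((b : B) → f (g b) ≡ b) → isEquiv f
isoToIsEquiv {A = A} {B = B} f g η ε y =
  ◁-isContr (◁-trans fiber◁ (Σ-◁ λ b → pathsThrough◁ b)) (isContrSingl y)
  where
  fiber◁ : fiber f y ◁ (Σ B λ b → f (g b) ≡ y)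
  fiber◁ = (λ (b , p) → g b , p) ,
           (λ (a , p) → f a , subst (λ a' → f a' ≡ y) (sym (η a)) p) ,
           λ (a , p) → Σ-≡,≡→≡ (η a , subst-subst-sym (η a))
  pathsThrough◁ : (b : B) → (f (g b) ≡ y) ◁ (b ≡ y)
  pathsThrough◁ b = trans (ε b) , trans (sym (ε b)) , trans-sym-cancel (ε b)

isoToEquiv : (f : A → B) (g : B → A) → ((a : A) → g (f a) ≡ a) → ((b : B) → f (g b) ≡ b) → A ≃ B
isoToEquiv f g η ε = f , isoToIsEquiv f g η ε

invEquiv : A ≃ B → B ≃ A
invEquiv e = isoToEquiv (invEq e) (proj₁ e) (secEq e) (retEq e)

compEquiv : A ≃ B → B ≃ C → A ≃ C
compEquiv e e' = isoToEquiv (λ a → proj₁ e' (proj₁ e a)) (λ c → invEq e (invEq e' c))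
  (λ a → trans (cong (invEq e) (retEq e' (proj₁ e a))) (retEq e a))
  (λ c → trans (cong (proj₁ e') (secEq e (invEq e' c))) (secEq e' c))

infixr 0 _≃⟨_⟩_
infix 1 _≃∎

_≃⟨_⟩_ : (A : Set ℓ) → A ≃ B → B ≃ C → A ≃ C
_ ≃⟨ e ⟩ e' = compEquiv e e'

_≃∎ : (A : Set ℓ) → A ≃ A
A ≃∎ = (λ a → a) , idIsEquiv A

Σ-cong-≃ : {F : A → Set ℓ'} {G : A → Set ℓ''} → ((a : A) → F a ≃ G a) → Σ A F ≃ Σ A G
Σ-cong-≃ e = isoToEquiv (λ (a , b) → a , proj₁ (e a) b) (λ (a , c) → a , invEq (e a) c)
  (λ (a , b) → cong (a ,_) (retEq (e a) b)) (λ (a , c) → cong (a ,_) (secEq (e a) c))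

×-congˡ-≃ : {A' : Set ℓ''} → A ≃ A' → (A × B) ≃ (A' × B)
×-congˡ-≃ e = isoToEquiv (λ (a , b) → proj₁ e a , b) (λ (a' , b) → invEq e a' , b)
  (λ (a , b) → cong (_, b) (retEq e a)) (λ (a' , b) → cong (_, b) (secEq e a'))

Σ-fiber-≃ : (f : A → B) → Σ B (fiber f) ≃ A
Σ-fiber-≃ f = isoToEquiv (λ (_ , a , _) → a) (λ a → f a , a , refl) (λ { (_ , a , refl) → refl }) (λ _ → refl)

Σ-splitByValue-≃ : {P : A → Set ℓ} {Y : Set ℓ'} {D : Y → Set ℓ''} (b : A → Y) →
  Σ (Σ A P) (λ s → D (b (proj₁ s))) ≃ Σ Y (λ y → (Σ A λ a → P a × (b a ≡ y)) × D y)
Σ-splitByValue-≃ {D = D} b = isoToEquiv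
  (λ ((a , p) , q) → b a , (a , p , refl) , q) (λ (_ , (a , p , e) , q) → (a , p) , subst D (sym e) q)
  (λ _ → refl) (λ { (_ , (a , p , refl) , q) → refl })

homotopy→fiber-≃ : {f h : A → B} → ((a : A) → h a ≡ f a) → (z : B) → fiber h z ≃ fiber f z
homotopy→fiber-≃ H z = isoToEquiv (λ (a , u) → a , trans (sym (H a)) u) (λ (a , v) → a , trans (H a) v)
  (λ (a , u) → cong (a ,_) (trans-sym-cancel (H a) u)) (λ (a , v) → cong (a ,_) (sym-trans-cancel (H a) v))

fiber-≡ : {f : A → B} {c c' : A} (γ : c ≡ c') {y z : B} (w : f c' ≡ y) (u : y ≡ z) →
  _≡_ {A = fiber f z} (c , trans (sym (trans (sym w) (cong f (sym γ)))) u) (c' , trans w u)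
fiber-≡ refl refl u = refl

isProp : Set ℓ → Set ℓ
isProp A = (x y : A) → x ≡ y

isContr→isProp : isContr A → isProp A
isContr→isProp (c , contract) x y = trans (sym (contract x)) (contract y)

isProp→isSet : isProp A → {x y : A} (p q : x ≡ y) → p ≡ q
isProp→isSet {A = A} φ {x} p q = trans (normal p) (sym (normal q))
  where
  φ-trans : {y : A} (p : x ≡ y) → trans (φ x x) p ≡ φ x y
  φ-trans refl = trans-reflʳ (φ x x)
  normal : {y : A} (p : x ≡ y) → p ≡ trans (sym (φ x x)) (φ x y)
  normal p = trans (sym (sym-trans-cancel (φ x x) p)) (cong (trans (sym (φ x x))) (φ-trans p))

isPropIsContr : {A : Set ℓ} → FunExt ℓ ℓ → isProp (isContr A)
isPropIsContr {A = A} fe (c , contract) (c' , contract') = go c' (contract c') contract'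
  where
  go : (c' : A) → c ≡ c' → (contract' : (x : A) → c' ≡ x) → (c , contract) ≡ (c' , contract')
  go c' refl contract' =
    cong (c ,_) (funext fe λ x → isProp→isSet (isContr→isProp (c , contract)) (contract x) (contract' x))

isPropIsEquiv : {A B : Set ℓ} → FunExt ℓ ℓ → (f : A → B) → isProp (isEquiv f)
isPropIsEquiv fe f p q = funext fe λ b → isPropIsContr fe (p b) (q b)

equivEq : {A B : Set ℓ} → FunExt ℓ ℓ → (e e' : A ≃ B) → ((a : A) → proj₁ e a ≡ proj₁ e' a) → e ≡ e'
equivEq fe (f , p) (g , q) H = Σ-≡,≡→≡ (funext fe H , isPropIsEquiv fe g _ q)

isContrTotal→◁≡ : {X : Set ℓ} {F : X → Set ℓ'} (c : X) (f₀ : F c) → isContr (Σ X F) →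
  (x : X) → F x ◁ (x ≡ c)
isContrTotal→◁≡ {X = X} {F = F} c f₀ total x =
  (λ p → subst F (sym p) f₀) , (λ t → sym (cong proj₁ (path t))) , λ t → go (x , t) (path t)
  where
  path : (t : F x) → (c , f₀) ≡ (x , t)
  path t = isContr→isProp total (c , f₀) (x , t)
  go : (w : Σ X F) (ρ : (c , f₀) ≡ w) → subst F (sym (sym (cong proj₁ ρ))) f₀ ≡ proj₂ w
  go _ refl = refl

Represents : {M : Set₁} → P M → (M → Set₁) → Set₁
Represents {M} q R = (z : M) → fiber (proj₂ q) z ≃ R z

Represents→≃ : {M : Set₁} {A B : Set} (f : A → M) (h : B → M) → Represents (B , h) (fiber f) → B ≃ A
Represents→≃ {M = M} {A} {B} f h ε =
  B               ≃⟨ invEquiv (Σ-fiber-≃ h) ⟩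
  Σ M (fiber h)   ≃⟨ Σ-cong-≃ ε ⟩
  Σ M (fiber f)   ≃⟨ Σ-fiber-≃ f ⟩
  A               ≃∎

module UniqueRepresentation (ua₀ : Univalence 0ℓ) (fe₀₁ : FunExt 0ℓ (Level.suc 0ℓ))
  (fe₁₁ : FunExt (Level.suc 0ℓ) (Level.suc 0ℓ)) {M : Set₁} where

  private
    coe : {A B : Set} → A ≡ B → A → B
    coe β = proj₁ (idtoeqv β)

    ua : {A B : Set} → A ≃ B → A ≡ B
    ua {A} {B} e = proj₁ (proj₁ (ua₀ A B e))

    coe-ua : {A B : Set} (e : A ≃ B) (a : A) → coe (ua e) a ≡ proj₁ e a
    coe-ua {A} {B} e a = cong (λ e' → proj₁ e' a) (proj₂ (proj₁ (ua₀ A B e)))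

    fiber-≃-over : {A B : Set} (f : A → M) (β : B ≡ A) (h : B → M) →
      ((b : B) → h b ≡ f (coe β b)) → Represents (B , h) (fiber f)
    fiber-≃-over f refl h H = homotopy→fiber-≃ H

    fiber-≃-over-apply : {A B : Set} (f : A → M) (β : B ≡ A) (h : B → M) (H : (b : B) → h b ≡ f (coe β b))
      (z : M) (b : B) (u : h b ≡ z) → proj₁ (fiber-≃-over f β h H z) (b , u) ≡ (coe β b , trans (sym (H b)) u)
    fiber-≃-over-apply f refl h H z b u = refl

  module _ {A : Set} (f : A → M) where

    Reindexing : Set₁
    Reindexing = Σ (Σ Set λ B → B ≡ A) λ (B , β) → Σ (B → M) λ h → (b : B) → h b ≡ f (coe β b)

    isContrReindexing : isContr Reindexing
    isContrReindexing = isContrΣ (isContrSingl A) λ (B , β) → isContrHomotopySingl fe₀₁ (λ b → f (coe β b))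

    toRepresents : Reindexing → Σ (P M) λ q → Represents q (fiber f)
    toRepresents ((B , β) , h , H) = (B , h) , fiber-≃-over f β h H

    -- ε induces an equivalence of total spaces B ≃ A, which univalence turns into a path.
    module _ (B : Set) (h : B → M) (ε : Represents (B , h) (fiber f)) where
      private
        e : B ≃ A
        e = Represents→≃ f h ε

        w : (b : B) → f (proj₁ e b) ≡ h b
        w b = proj₂ (proj₁ (ε (h b)) (b , refl))

        ε-apply : (z : M) (b : B) (u : h b ≡ z) → proj₁ (ε z) (b , u) ≡ (proj₁ e b , trans (w b) u)
        ε-apply _ b refl = cong (proj₁ e b ,_) (sym (trans-reflʳ (w b)))

        H : (b : B) → h b ≡ f (coe (ua e) b)
        H b = trans (sym (w b)) (cong f (sym (coe-ua e b)))

      fromRepresents : Reindexing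
      fromRepresents = (B , ua e) , h , H

      toRepresents-fromRepresents : toRepresents fromRepresents ≡ ((B , h) , ε)
      toRepresents-fromRepresents = cong ((B , h) ,_) (funext fe₁₁ λ z → equivEq fe₁₁ _ _ λ (b , u) →
        trans (fiber-≃-over-apply f (ua e) h H z b u) (trans (fiber-≡ (coe-ua e b) (w b) u) (sym (ε-apply z b u))))

    isContr-Represents-fiber : isContr (Σ (P M) λ q → Represents q (fiber f))
    isContr-Represents-fiber = ◁-isContr
      (toRepresents , (λ ((B , h) , ε) → fromRepresents B h ε) , λ ((B , h) , ε) → toRepresents-fromRepresents B h ε)
      isContrReindexing

  isContr-Represents : {A : Set} (f : A → M) {R : M → Set₁} → Represents (A , f) R →
    isContr (Σ (P M) λ q → Represents q R)
  isContr-Represents f ψ = ◁-isContr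
    (Σ-◁ λ q → (λ ε z → compEquiv (ε z) (ψ z)) , (λ ε z → compEquiv (ε z) (invEquiv (ψ z))) ,
               λ ε → funext fe₁₁ λ z → equivEq fe₁₁ _ _ λ x → secEq (ψ z) (proj₁ (ε z) x))
    (isContr-Represents-fiber f)

module AntiFoundation (ua₀ : Univalence 0ℓ) (fe₀₁ : FunExt 0ℓ (Level.suc 0ℓ))
  (fe₁₁ : FunExt (Level.suc 0ℓ) (Level.suc 0ℓ)) (𝕄 : MInfty) (π : Pairing 𝕄)
  (g : MInfty.M 𝕄) (graph : isGraph 𝕄 π g) where

  open MInfty 𝕄
  open Pairing π
  open UniqueRepresentation ua₀ fe₀₁ fe₁₁ {M}

  private
    Edge : Set
    Edge = proj₁ (desup g)

    source target : Edge → M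
    source a = proj₁ (graph (proj₂ (desup g) a) (a , refl))
    target a = proj₁ (proj₂ (graph (proj₂ (desup g) a) (a , refl)))

    edge-pair : (a : Edge) → proj₂ (desup g) a ≡ ⟨ source a , target a ⟩
    edge-pair a = proj₂ (proj₂ (graph (proj₂ (desup g) a) (a , refl)))

    SourceIs : Edge → M → Set
    SourceIs a x = proj₁ (locSmall (source a) x)

    successors : M → P M
    successors x = (Σ Edge λ a → SourceIs a x) , λ s → target (proj₁ s)

    edges-≃ : (x y : M) → (Σ Edge λ a → SourceIs a x × (target a ≡ y)) ≃ _∈_ 𝕄 ⟨ x , y ⟩ g
    edges-≃ x y = Σ-cong-≃ λ a →
      SourceIs a x × (target a ≡ y)          ≃⟨ ×-congˡ-≃ (proj₂ (locSmall (source a) x)) ⟩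
      (source a ≡ x) × (target a ≡ y)         ≃⟨ pairMap 𝕄 ⟨_,_⟩ _ _ _ _ , pairEq _ _ _ _ ⟩
      ⟨ source a , target a ⟩ ≡ ⟨ x , y ⟩     ≃⟨ idtoeqv (cong (_≡ ⟨ x , y ⟩) (sym (edge-pair a))) ⟩
      proj₂ (desup g) a ≡ ⟨ x , y ⟩           ≃∎

    DecoratedSuccessor : (M → M) → M → M → Set₁
    DecoratedSuccessor d x z = Σ M λ y → _∈_ 𝕄 ⟨ x , y ⟩ g × (d y ≡ z)

    successors-represent : (d : M → M) (x : M) → Represents (Pmap d (successors x)) (DecoratedSuccessor d x)
    successors-represent d x z =
      fiber (λ s → d (target (proj₁ s))) z
        ≃⟨ Σ-splitByValue-≃ target ⟩
      Σ M (λ y → (Σ Edge λ a → SourceIs a x × (target a ≡ y)) × (d y ≡ z))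
        ≃⟨ Σ-cong-≃ (λ y → ×-congˡ-≃ (edges-≃ x y)) ⟩
      DecoratedSuccessor d x z
        ≃∎

  isContr-MAFA : isContr (MAFA-type 𝕄 π g)
  isContr-MAFA = ◁-isContr
    (Σ-◁ λ d → Π-◁ fe₁₁ λ x →
      isContrTotal→◁≡ (Pmap d (successors x)) (successors-represent d x)
        (isContr-Represents (proj₂ (Pmap d (successors x))) (successors-represent d x)) (desup (d x)))
    (final M successors)

mainTheorem4 : Univalence 0ℓ → Univalence (Level.suc 0ℓ) →
    FunExt 0ℓ 0ℓ → FunExt (Level.suc 0ℓ) (Level.suc 0ℓ) → FunExt 0ℓ (Level.suc 0ℓ) → FunExt (Level.suc 0ℓ) 0ℓ →
    (𝕄 : MInfty) (π : Pairing 𝕄) (g : MInfty.M 𝕄) →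
    isGraph 𝕄 π g → isContr (MAFA-type 𝕄 π g)
mainTheorem4 ua₀ _ _ fe₁₁ fe₀₁ _ = AntiFoundation.isContr-MAFA ua₀ fe₀₁ fe₁₁
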